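{- For every finite hypergraph $H=(V,E)$ (multiple edges allowed, every edge of size at least $2$), $$\chi_L(H)\le\chi_P(H)\le 2\lceil\mathrm{ed}(H)\rceil+1.$$
   Context: A coloring of the vertices of $H$ is proper if no edge is monochromatic. $\chi_L(H)$ (list chromatic number) is the least $k$ such that for every assignment of lists of $k$ colors to the vertices there is a proper coloring choosing each vertex's color from its list. Paintability: for $f:V\to\mathbb N\cup\{0\}$, $H$ is $f$-paintable if (i) $f(v)>0$ for all $v\in V$, and (ii) for every nonempty $X\subseteq V$ there is an independent set $X'\subseteq X$ (no edge $e\subseteq X'$) such that $H-X'$ is $f'$-paintable, where $f':V\setminus X'\to\mathbb N\cup\{0\}$ is $f'(v)=f(v)-1$ for $v\in X$ and $f'(v)=f(v)$ for $v\notin X$; the hypergraph with empty vertex set is $f$-paintable. $\chi_P(H)$ is the least $k$ such that $H$ is $f$-paintable for the constant function $f\equiv k$. The edge density is $\mathrm{ed}(H)=\max_{\emptyset\neq X\subseteq V}|E(X)|/|X|$, where $E(X)=\{e\in E:e\subseteq X\}$ counted with multiplicity. -}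

module Defs where

open import Data.Nat using (ℕ; zero; suc; _+_; _*_; _∸_; _≤_; _<_; _⊔_)
open import Data.Nat.DivMod using (_/_)
open import Data.Fin using (Fin)
open import Data.Fin.Subset using (Subset; _∈_; _⊆_; _─_; ∣_∣; Nonempty; ⊤; inside; outside)
open import Data.Fin.Subset.Properties using (_⊆?_)
open import Data.Vec using ([]; _∷_)
open import Data.List using (List; []; _∷_; length; filter; map; foldr; _++_)
open import Data.List.Relation.Unary.All using (All)
open import Data.List.Relation.Unary.Unique.Propositional using (Unique)
import Data.List.Membership.Propositional as LMem
open import Data.Product using (Σ; ∃; _×_)
open import Data.Bool using (if_then_else_)
open import Relation.Nullary using (¬_; does)
open import Relation.Binary.PropositionalEquality using (_≡_)

-- Finite hypergraphs on the vertex set Fin n.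
-- Edges form a list (so multiple edges are allowed), each edge a subset
-- of the vertex set of size at least 2.

record Hypergraph : Set where
  field
    n         : ℕ
    edges     : List (Subset n)
    edges≥2   : All (λ e → 2 ≤ ∣ e ∣) edges

open Hypergraph public

Monochromatic : ∀ {n} → (Fin n → ℕ) → Subset n → Set
Monochromatic {n} c e = ∃ λ (a : ℕ) → ∀ (v : Fin n) → v ∈ e → c v ≡ a

Proper : (H : Hypergraph) → (Fin (n H) → ℕ) → Set
Proper H c = ∀ e → e LMem.∈ edges H → ¬ Monochromatic c e

Choosable : Hypergraph → ℕ → Set
Choosable H k =
  (L : Fin (n H) → List ℕ) →
  (∀ v → length (L v) ≡ k) →
  (∀ v → Unique (L v)) →
  Σ (Fin (n H) → ℕ) λ c → (∀ v → c v LMem.∈ L v) × Proper H c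

-- Paintability.  The current hypergraph is H restricted to the alive
-- vertex set A (induced subhypergraph: edges contained in A).
-- f only matters on A.

Independent : (H : Hypergraph) → Subset (n H) → Set
Independent H X = ∀ e → e LMem.∈ edges H → ¬ (e ⊆ X)

decr : ∀ {m} → Subset m → (Fin m → ℕ) → Fin m → ℕ
decr [] f v = f v
decr {suc m} (inside  ∷ X) f Fin.zero    = f Fin.zero ∸ 1
decr {suc m} (outside ∷ X) f Fin.zero    = f Fin.zero
decr {suc m} (b ∷ X)       f (Fin.suc v) = decr X (λ w → f (Fin.suc w)) v

data Paintable (H : Hypergraph) (A : Subset (n H)) (f : Fin (n H) → ℕ) : Set where
  paint :
    (∀ v → v ∈ A → 0 < f v) →
    (∀ (X : Subset (n H)) → X ⊆ A → Nonempty X →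
       Σ (Subset (n H)) λ X' → X' ⊆ X × Independent H X' ×
         Paintable H (A ─ X') (decr X f)) →
    Paintable H A f

KPaintable : Hypergraph → ℕ → Set
KPaintable H k = Paintable H ⊤ (λ _ → k)

IsLeast : (ℕ → Set) → ℕ → Set
IsLeast P k = P k × (∀ j → P j → k ≤ j)

IsListChromatic : Hypergraph → ℕ → Set
IsListChromatic H = IsLeast (Choosable H)

IsPaintNumber : Hypergraph → ℕ → Set
IsPaintNumber H = IsLeast (KPaintable H)

-- Ceiling of the edge density.
-- ⌈ed(H)⌉ = max over nonempty X of ⌈ |E(X)| / |X| ⌉
-- (ceiling commutes with a finite maximum).

allSubsets : ∀ m → List (Subset m)
allSubsets zero    = [] ∷ []
allSubsets (suc m) = map (inside ∷_) (allSubsets m) ++ map (outside ∷_) (allSubsets m)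

edgesIn : (H : Hypergraph) → Subset (n H) → ℕ
edgesIn H X = length (filter (λ e → e ⊆? X) (edges H))

-- ⌈ a / b ⌉, with value 0 when b = 0 (used only for the empty set X,
-- which contributes nothing since E(∅) is empty)
ceilDiv : ℕ → ℕ → ℕ
ceilDiv a zero    = 0
ceilDiv a (suc m) = (a + m) / suc m

ceilEd : Hypergraph → ℕ
ceilEd H = foldr (λ X r → ceilDiv (edgesIn H X) ∣ X ∣ ⊔ r) 0 (allSubsets (n H))

-- A painting strategy yields list colourings: offer the colours one at a time, marking the
-- alive vertices whose list contains the current colour, and give that colour to the
-- painter's answer.
--
-- For the upper bound let d = ⌈ed(H)⌉.  The density condition |E(X)| ≤ d|X| is Hall's
-- condition for giving every edge an owner among its vertices so that no vertex owns more
-- than d edges (Hakimi): if an edge cannot be given to any of its vertices, each of them lies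
-- in a tight set; tight sets are closed under union by submodularity, so their union violates
-- the density condition.  Replacing each edge by the pair formed by its owner and another of
-- its vertices gives a graph G with at most d|A| edges inside every vertex set A, so every A
-- contains a vertex of degree at most 2d in G[A].  Adding such vertices one at a time shows
-- that G, and hence H (each edge of H contains an edge of G), is (2d+1)-paintable.
--
-- Both numbers exist as least elements because paintability and choosability are decidable;
-- for choosability, colours can be renamed into {0, …, nk − 1}.

module Submission where

open import Data.Nat using (ℕ; zero; suc; _+_; _*_; _∸_; _≤_; _<_; _⊔_; z≤n; s≤s; _≤?_; _<?_; >-nonZero)
open import Data.Nat.DivMod using (_/_; _%_; m≡m%n+[m/n]*n; m%n<n)
open import Data.Nat.Properties hiding (_≟_)
import Data.Nat.Properties as ℕ
open import Algebra.Properties.CommutativeSemigroup +-commutativeSemigroup using (interchange; x∙yz≈y∙xz)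
open import Data.Bool using (if_then_else_)
open import Data.Empty using (⊥-elim)
open import Data.Fin using (Fin; zero; suc)
open import Data.Fin.Properties using (_≟_; any?; all?)
open import Data.Fin.Subset using (Subset; _∈_; _∉_; _⊆_; _─_; _-_; _∪_; _∩_; ∣_∣; Nonempty; ⊤; ⊥; inside; outside; ⁅_⁆)
open import Data.Fin.Subset.Properties
  using ( _∈?_; _⊆?_; nonempty?; anySubset?; ∈⊤; ⊆⊤; ⊆-trans; x∈⁅x⁆; x∈⁅y⁆⇒x≡y; p⊆p∪q; q⊆p∪q; x∈p∪q⁻; x∈p∩q⁺
        ; ∩-zeroʳ; ∪-comm; p─q⊆p; x∈p∧x∉q⇒x∈p─q; x∈p∧x≢y⇒x∈p-y; p─q─r≡p─r─q; p─q─r≡p─q∪r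
        ; ∣p∣≤n; ∣p∣≤∣x∷p∣; ∣⊥∣≡0; ∣⁅x⁆∣≡1; p⊆q⇒∣p∣≤∣q∣; p⊂q⇒∣p∣<∣q∣; x∈p⇒∣p-x∣<∣p∣ )
open import Data.List using (List; []; _∷_; length; filter; foldr; map; _++_; upTo; allFin; cartesianProductWith)
open import Data.List.Properties using (filter-none; filter-all; filter-reject; filter-accept; length-map; length-++)
open import Data.List.Membership.Propositional using (find; lose) renaming (_∈_ to _∈ˡ_)
open import Data.List.Membership.Propositional.Properties
  using (∈-allFin; ∈-filter⁺; ∈-filter⁻; ∈-map⁺; ∈-map⁻; ∈-++⁺ˡ; ∈-++⁺ʳ; ∈-upTo⁺; ∈-cartesianProductWith⁺)
open import Data.List.Membership.DecPropositional ℕ._≟_ using () renaming (_∈?_ to _∈ˡ?_)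
open import Data.List.Relation.Binary.Pointwise using (Pointwise; []; _∷_)
open import Data.List.Relation.Unary.All using (All; []; _∷_)
import Data.List.Relation.Unary.All as All
import Data.List.Relation.Unary.All.Properties as AllP
import Data.List.Relation.Unary.Any as Any
open import Data.List.Relation.Unary.Any using (Any)
open import Data.List.Relation.Unary.AllPairs using ([]; _∷_)
open import Data.List.Relation.Unary.Unique.Propositional using (Unique)
import Data.List.Relation.Unary.Unique.Propositional.Properties as Unique
open import Data.List.Relation.Unary.Unique.DecPropositional ℕ._≟_ using (unique?)
open import Data.Product using (Σ; ∃; _×_; _,_; proj₁; proj₂)
open import Data.Sum using (_⊎_; inj₁; inj₂; [_,_])
open import Data.Vec using ([]; _∷_; here; there; tabulate)
import Data.Vec.Functional as Vector
open import Function using (_∘_; id)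
open import Relation.Binary.PropositionalEquality
  using (_≡_; _≢_; refl; sym; trans; cong; cong₂; subst; module ≡-Reasoning)
open import Relation.Nullary using (¬_; Dec; yes; no; does; ¬?; _×-dec_)
open import Relation.Nullary.Decidable using (decidable-stable; map′; _→-dec_)
open import Relation.Unary using (Decidable)

open import Defs

least : ∀ {P : ℕ → Set} → Decidable P → ∀ K → P K → Σ ℕ (IsLeast P)
least P? K pK with P? 0
... | yes p0 = 0 , p0 , λ _ _ → z≤n
least P? zero    pK | no ¬p0 = ⊥-elim (¬p0 pK)
least P? (suc K) pK | no ¬p0 with least (P? ∘ suc) K pK
... | k , pk , minimal = suc k , pk , λ { zero p0 → ⊥-elim (¬p0 p0) ; (suc j) pj → s≤s (minimal j pj) }

∀-subset? : ∀ {k} {P : Subset k → Set} → Decidable P → Dec (∀ X → P X)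
∀-subset? P? with anySubset? (¬? ∘ P?)
... | yes (X , ¬pX) = no λ all → ¬pX (all X)
... | no  ¬any      = yes λ X → decidable-stable (P? X) λ ¬pX → ¬any (X , ¬pX)

∀∈? : ∀ {A : Set} {P : A → Set} → Decidable P → ∀ xs → Dec (∀ x → x ∈ˡ xs → P x)
∀∈? P? xs = map′ (λ all x → All.lookup all) (λ all → All.tabulate (all _)) (All.all? P? xs)

Choice : ∀ {n} {A : Set} → (Fin n → List A) → ((Fin n → A) → Set) → Set
Choice S P = ∃ λ c → (∀ v → c v ∈ˡ S v) × P c

∃-choice? : ∀ {n} {A : Set} (S : Fin n → List A) {P : (Fin n → A) → Set} →
            (∀ {c c′} → (∀ v → c v ≡ c′ v) → P c → P c′) → Decidable P → Dec (Choice S P)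
∃-choice? {zero}  S resp P? = map′ (λ p → empty , (λ ()) , p) (λ (c , _ , p) → resp (λ ()) p) (P? empty)
  where empty = λ ()
∃-choice? {suc n} S {P} resp P? = map′ extend restrict (Any.any? choice-after? (S zero))
  where
  choice-after? : ∀ a → Dec (Choice (S ∘ suc) (P ∘ (a Vector.∷_)))
  choice-after? a = ∃-choice? (S ∘ suc) (λ eq → resp (λ { zero → refl ; (suc v) → eq v })) (P? ∘ (a Vector.∷_))
  extend : Any (λ a → Choice (S ∘ suc) (P ∘ (a Vector.∷_))) (S zero) → Choice S P
  extend any = let (a , a∈ , c , c∈ , p) = find any in (a Vector.∷ c) , (λ { zero → a∈ ; (suc v) → c∈ v }) , p
  restrict : Choice S P → Any (λ a → Choice (S ∘ suc) (P ∘ (a Vector.∷_))) (S zero)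
  restrict (c , c∈ , p) = lose (c∈ zero) (c ∘ suc , c∈ ∘ suc , resp (λ { zero → refl ; (suc v) → refl }) p)

∀-choice? : ∀ {n} {A : Set} (S : Fin n → List A) {P : (Fin n → A) → Set} →
            (∀ {c c′} → (∀ v → c v ≡ c′ v) → P c → P c′) → Decidable P → Dec (∀ c → (∀ v → c v ∈ˡ S v) → P c)
∀-choice? S resp P? with ∃-choice? S (λ eq ¬pc pc′ → ¬pc (resp (sym ∘ eq) pc′)) (¬? ∘ P?)
... | yes (c , c∈ , ¬pc) = no λ all → ¬pc (all c c∈)
... | no  ¬any           = yes λ c c∈ → decidable-stable (P? c) λ ¬pc → ¬any (c , c∈ , ¬pc)

⟦_⟧ : ∀ {k p} {P : Fin k → Set p} → Decidable P → Subset k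
⟦ P? ⟧ = tabulate (λ v → does (P? v))

∈⟦⟧⁺ : ∀ {k p} {P : Fin k → Set p} (P? : Decidable P) {v} → P v → v ∈ ⟦ P? ⟧
∈⟦⟧⁺ P? {zero} p with P? zero
... | yes _ = here
... | no ¬p = ⊥-elim (¬p p)
∈⟦⟧⁺ P? {suc v} p = there (∈⟦⟧⁺ (P? ∘ suc) p)

∈⟦⟧⁻ : ∀ {k p} {P : Fin k → Set p} (P? : Decidable P) {v} → v ∈ ⟦ P? ⟧ → P v
∈⟦⟧⁻ P? {zero} v∈ with P? zero
∈⟦⟧⁻ P? {zero} here | yes p = p
∈⟦⟧⁻ P? {suc v} (there v∈) = ∈⟦⟧⁻ (P? ∘ suc) v∈

x∈p─q⇒x∉q : ∀ {k} {p q : Subset k} {x} → x ∈ p ─ q → x ∉ q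
x∈p─q⇒x∉q {p = _ ∷ p} {inside  ∷ q} (there x∈) (there x∈q) = x∈p─q⇒x∉q x∈ x∈q
x∈p─q⇒x∉q {p = _ ∷ p} {outside ∷ q} (there x∈) (there x∈q) = x∈p─q⇒x∉q x∈ x∈q

p⊆q⇒p─r⊆q─r : ∀ {k} {p q : Subset k} r → p ⊆ q → p ─ r ⊆ q ─ r
p⊆q⇒p─r⊆q─r {p = p} r p⊆q x∈ = x∈p∧x∉q⇒x∈p─q (p⊆q (p─q⊆p p r x∈)) (x∈p─q⇒x∉q x∈)

x∈p⇒0<∣p∣ : ∀ {k} {A : Subset k} {x} → x ∈ A → 0 < ∣ A ∣
x∈p⇒0<∣p∣ {A = inside ∷ A} here       = s≤s z≤n
x∈p⇒0<∣p∣ {A = b      ∷ A} (there x∈) = ≤-trans (x∈p⇒0<∣p∣ x∈) (∣p∣≤∣x∷p∣ b A)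

0<∣p∣⇒nonempty : ∀ {k} (A : Subset k) → 0 < ∣ A ∣ → Nonempty A
0<∣p∣⇒nonempty (inside  ∷ A) _  = zero , here
0<∣p∣⇒nonempty (outside ∷ A) ∣A∣>0 = let (v , v∈A) = 0<∣p∣⇒nonempty A ∣A∣>0 in suc v , there v∈A

∣p∪q∣≤∣p∣+∣q∣ : ∀ {k} (p q : Subset k) → ∣ p ∪ q ∣ ≤ ∣ p ∣ + ∣ q ∣
∣p∪q∣≤∣p∣+∣q∣ []            []            = z≤n
∣p∪q∣≤∣p∣+∣q∣ (inside  ∷ p) (inside  ∷ q) = s≤s (≤-trans (∣p∪q∣≤∣p∣+∣q∣ p q) (+-monoʳ-≤ ∣ p ∣ (n≤1+n ∣ q ∣)))
∣p∪q∣≤∣p∣+∣q∣ (inside  ∷ p) (outside ∷ q) = s≤s (∣p∪q∣≤∣p∣+∣q∣ p q)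
∣p∪q∣≤∣p∣+∣q∣ (outside ∷ p) (inside  ∷ q) = ≤-trans (s≤s (∣p∪q∣≤∣p∣+∣q∣ p q)) (≤-reflexive (sym (+-suc ∣ p ∣ ∣ q ∣)))
∣p∪q∣≤∣p∣+∣q∣ (outside ∷ p) (outside ∷ q) = ∣p∪q∣≤∣p∣+∣q∣ p q

other-vertex : ∀ {k} (e : Subset k) v → 2 ≤ ∣ e ∣ → ∃ λ u → u ∈ e × u ≢ v
other-vertex e v ∣e∣≥2 with any? (λ u → u ∈? e ×-dec ¬? (u ≟ v))
... | yes found = found
... | no ¬found = ⊥-elim (<⇒≱ ∣e∣≥2 (≤-trans (p⊆q⇒∣p∣≤∣q∣ e⊆⁅v⁆) (≤-reflexive (∣⁅x⁆∣≡1 v))))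
  where
  e⊆⁅v⁆ : e ⊆ ⁅ v ⁆
  e⊆⁅v⁆ {u} u∈e = subst (_∈ ⁅ v ⁆) (sym (decidable-stable (u ≟ v) λ u≢v → ¬found (u , u∈e , u≢v))) (x∈⁅x⁆ v)

p⊆r⇒x∈r⇒p∪⁅x⁆⊆r : ∀ {k} {p r : Subset k} {x} → p ⊆ r → x ∈ r → p ∪ ⁅ x ⁆ ⊆ r
p⊆r⇒x∈r⇒p∪⁅x⁆⊆r {p = p} {r} {x} p⊆r x∈r u∈ =
  [ p⊆r , (λ u∈⁅x⁆ → subst (_∈ r) (sym (x∈⁅y⁆⇒x≡y x u∈⁅x⁆)) x∈r) ] (x∈p∪q⁻ p ⁅ x ⁆ u∈)

∣pair∣≤2 : ∀ {k} (a b : Fin k) → ∣ ⁅ a ⁆ ∪ ⁅ b ⁆ ∣ ≤ 2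
∣pair∣≤2 a b = ≤-trans (∣p∪q∣≤∣p∣+∣q∣ ⁅ a ⁆ ⁅ b ⁆) (≤-reflexive (cong₂ _+_ (∣⁅x⁆∣≡1 a) (∣⁅x⁆∣≡1 b)))

∣pair∣≥2 : ∀ {k} {a b : Fin k} → b ≢ a → 2 ≤ ∣ ⁅ a ⁆ ∪ ⁅ b ⁆ ∣
∣pair∣≥2 {a = a} {b} b≢a = subst (_< ∣ ⁅ a ⁆ ∪ ⁅ b ⁆ ∣) (∣⁅x⁆∣≡1 a)
  (p⊂q⇒∣p∣<∣q∣ (p⊆p∪q ⁅ b ⁆ , b , q⊆p∪q ⁅ a ⁆ ⁅ b ⁆ (x∈⁅x⁆ b) , λ b∈⁅a⁆ → b≢a (x∈⁅y⁆⇒x≡y a b∈⁅a⁆)))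

∑∈ : ∀ {k} → Subset k → (Fin k → ℕ) → ℕ
∑∈ []            f = 0
∑∈ (inside  ∷ A) f = f zero + ∑∈ A (f ∘ suc)
∑∈ (outside ∷ A) f = ∑∈ A (f ∘ suc)

syntax ∑∈ A (λ v → t) = ∑[ v ∈ A ] t

∑-const : ∀ {k} (A : Subset k) d → ∑[ _ ∈ A ] d ≡ d * ∣ A ∣
∑-const []            d = sym (*-zeroʳ d)
∑-const (inside  ∷ A) d = trans (cong (d +_) (∑-const A d)) (sym (*-suc d ∣ A ∣))
∑-const (outside ∷ A) d = ∑-const A d

∑-mono : ∀ {k} (A : Subset k) {f g : Fin k → ℕ} → (∀ v → v ∈ A → f v ≤ g v) → ∑∈ A f ≤ ∑∈ A g
∑-mono []            f≤g = z≤n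
∑-mono (inside  ∷ A) f≤g = +-mono-≤ (f≤g zero here) (∑-mono A (λ v v∈ → f≤g (suc v) (there v∈)))
∑-mono (outside ∷ A) f≤g = ∑-mono A (λ v v∈ → f≤g (suc v) (there v∈))

∑-+ : ∀ {k} (A : Subset k) (f g : Fin k → ℕ) → ∑[ v ∈ A ] (f v + g v) ≡ ∑∈ A f + ∑∈ A g
∑-+ []            f g = refl
∑-+ (inside  ∷ A) f g = begin
  (f zero + g zero) + ∑[ v ∈ A ] (f (suc v) + g (suc v)) ≡⟨ cong (f zero + g zero +_) (∑-+ A (f ∘ suc) (g ∘ suc)) ⟩
  (f zero + g zero) + (∑∈ A (f ∘ suc) + ∑∈ A (g ∘ suc))  ≡⟨ interchange (f zero) (g zero) _ _ ⟩
  (f zero + ∑∈ A (f ∘ suc)) + (g zero + ∑∈ A (g ∘ suc))  ∎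
  where open ≡-Reasoning
∑-+ (outside ∷ A) f g = ∑-+ A (f ∘ suc) (g ∘ suc)

∑-∪-∩ : ∀ {k} (X Y : Subset k) f → ∑∈ (X ∪ Y) f + ∑∈ (X ∩ Y) f ≡ ∑∈ X f + ∑∈ Y f
∑-∪-∩ []            []            f = refl
∑-∪-∩ (inside  ∷ X) (inside  ∷ Y) f = begin
  (a + ∑∈ (X ∪ Y) f′) + (a + ∑∈ (X ∩ Y) f′) ≡⟨ interchange a _ a _ ⟩
  (a + a) + (∑∈ (X ∪ Y) f′ + ∑∈ (X ∩ Y) f′) ≡⟨ cong (a + a +_) (∑-∪-∩ X Y f′) ⟩
  (a + a) + (∑∈ X f′ + ∑∈ Y f′)             ≡⟨ interchange a a _ _ ⟩
  (a + ∑∈ X f′) + (a + ∑∈ Y f′)             ∎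
  where open ≡-Reasoning; a = f zero; f′ = f ∘ suc
∑-∪-∩ (inside  ∷ X) (outside ∷ Y) f = begin
  (f zero + ∑∈ (X ∪ Y) f′) + ∑∈ (X ∩ Y) f′ ≡⟨ +-assoc (f zero) _ _ ⟩
  f zero + (∑∈ (X ∪ Y) f′ + ∑∈ (X ∩ Y) f′) ≡⟨ cong (f zero +_) (∑-∪-∩ X Y f′) ⟩
  f zero + (∑∈ X f′ + ∑∈ Y f′)             ≡⟨ +-assoc (f zero) _ _ ⟨
  (f zero + ∑∈ X f′) + ∑∈ Y f′             ∎
  where open ≡-Reasoning; f′ = f ∘ suc
∑-∪-∩ (outside ∷ X) (inside  ∷ Y) f = begin
  (f zero + ∑∈ (X ∪ Y) f′) + ∑∈ (X ∩ Y) f′ ≡⟨ +-assoc (f zero) _ _ ⟩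
  f zero + (∑∈ (X ∪ Y) f′ + ∑∈ (X ∩ Y) f′) ≡⟨ cong (f zero +_) (∑-∪-∩ X Y f′) ⟩
  f zero + (∑∈ X f′ + ∑∈ Y f′)             ≡⟨ x∙yz≈y∙xz (f zero) (∑∈ X f′) (∑∈ Y f′) ⟩
  ∑∈ X f′ + (f zero + ∑∈ Y f′)             ∎
  where open ≡-Reasoning; f′ = f ∘ suc
∑-∪-∩ (outside ∷ X) (outside ∷ Y) f = ∑-∪-∩ X Y (f ∘ suc)

∑-⊥ : ∀ {k} f → ∑∈ (⊥ {k}) f ≡ 0
∑-⊥ {zero}  f = refl
∑-⊥ {suc k} f = ∑-⊥ (f ∘ suc)

∑-⁅⁆ : ∀ {k} (x : Fin k) f → ∑∈ ⁅ x ⁆ f ≡ f x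
∑-⁅⁆ zero    f = trans (cong (f zero +_) (∑-⊥ (f ∘ suc))) (+-identityʳ (f zero))
∑-⁅⁆ (suc x) f = ∑-⁅⁆ x (f ∘ suc)

∑-─ : ∀ {k} (A B : Subset k) f → ∑∈ (A ─ B) f ≤ ∑∈ A f
∑-─ []            []            f = z≤n
∑-─ (inside  ∷ A) (inside  ∷ B) f = ≤-trans (∑-─ A B (f ∘ suc)) (m≤n+m _ (f zero))
∑-─ (inside  ∷ A) (outside ∷ B) f = +-monoʳ-≤ (f zero) (∑-─ A B (f ∘ suc))
∑-─ (outside ∷ A) (inside  ∷ B) f = ∑-─ A B (f ∘ suc)
∑-─ (outside ∷ A) (outside ∷ B) f = ∑-─ A B (f ∘ suc)

∑-average : ∀ {k} (A : Subset k) f c → Nonempty A → ∑∈ A f ≤ c * ∣ A ∣ → ∃ λ v → v ∈ A × f v ≤ c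
∑-average A f c (w , w∈A) ∑≤ with any? (λ v → v ∈? A ×-dec f v ≤? c)
... | yes found = found
... | no ¬found = ⊥-elim (<⇒≱ (m<n+m (c * ∣ A ∣) (x∈p⇒0<∣p∣ w∈A)) (begin
  suc c * ∣ A ∣     ≡⟨ ∑-const A (suc c) ⟨
  ∑[ _ ∈ A ] suc c  ≤⟨ ∑-mono A (λ v v∈A → ≰⇒> (λ fv≤c → ¬found (v , v∈A , fv≤c))) ⟩
  ∑∈ A f            ≤⟨ ∑≤ ⟩
  c * ∣ A ∣         ∎))
  where open ≤-Reasoning

-- Defined through does, so that 𝟙[ suc v ∈? b ∷ e ] reduces to 𝟙[ v ∈? e ].
𝟙[_] : ∀ {p} {P : Set p} → Dec P → ℕ
𝟙[ P? ] = if does P? then 1 else 0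

𝟙-yes : ∀ {p} {P : Set p} (P? : Dec P) → P → 𝟙[ P? ] ≡ 1
𝟙-yes (yes _) _  = refl
𝟙-yes (no ¬p) p = ⊥-elim (¬p p)

𝟙-no : ∀ {p} {P : Set p} (P? : Dec P) → ¬ P → 𝟙[ P? ] ≡ 0
𝟙-no (yes p) ¬p = ⊥-elim (¬p p)
𝟙-no (no _)  _  = refl

𝟙-mono : ∀ {p q} {P : Set p} {Q : Set q} (P? : Dec P) (Q? : Dec Q) → (P → Q) → 𝟙[ P? ] ≤ 𝟙[ Q? ]
𝟙-mono (yes p) (yes _) _   = ≤-refl
𝟙-mono (yes p) (no ¬q) P→Q = ⊥-elim (¬q (P→Q p))
𝟙-mono (no _)  _       _   = z≤n

∑-𝟙∈ : ∀ {k} (A e : Subset k) → ∑[ v ∈ A ] 𝟙[ v ∈? e ] ≤ ∣ e ∣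
∑-𝟙∈ []            []            = z≤n
∑-𝟙∈ (inside  ∷ A) (inside  ∷ e) = s≤s (∑-𝟙∈ A e)
∑-𝟙∈ (inside  ∷ A) (outside ∷ e) = ∑-𝟙∈ A e
∑-𝟙∈ (outside ∷ A) (b       ∷ e) = ≤-trans (∑-𝟙∈ A e) (∣p∣≤∣x∷p∣ b e)

∣p∩⁅x⁆∣≡𝟙[x∈p] : ∀ {k} (A : Subset k) x → ∣ A ∩ ⁅ x ⁆ ∣ ≡ 𝟙[ x ∈? A ]
∣p∩⁅x⁆∣≡𝟙[x∈p] {suc k} (inside  ∷ A) zero    = cong suc (trans (cong ∣_∣ (∩-zeroʳ A)) (∣⊥∣≡0 k))
∣p∩⁅x⁆∣≡𝟙[x∈p] {suc k} (outside ∷ A) zero    = trans (cong ∣_∣ (∩-zeroʳ A)) (∣⊥∣≡0 k)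
∣p∩⁅x⁆∣≡𝟙[x∈p] (inside  ∷ A) (suc x) = ∣p∩⁅x⁆∣≡𝟙[x∈p] A x
∣p∩⁅x⁆∣≡𝟙[x∈p] (outside ∷ A) (suc x) = ∣p∩⁅x⁆∣≡𝟙[x∈p] A x

∑-decr : ∀ {k} (A X : Subset k) f → (∀ v → v ∈ A → v ∈ X → 0 < f v) →
         ∑∈ A (decr X f) + ∣ A ∩ X ∣ ≡ ∑∈ A f
∑-decr []      []      f pos = refl
∑-decr (a ∷ A) (b ∷ X) f pos with ∑-decr A X (f ∘ suc) (λ v v∈A v∈X → pos (suc v) (there v∈A) (there v∈X))
∑-decr (inside  ∷ A) (inside  ∷ X) f pos | ih = begin
  (f zero ∸ 1 + ∑∈ A (decr X f′)) + suc ∣ A ∩ X ∣ ≡⟨ +-suc _ ∣ A ∩ X ∣ ⟩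
  suc (f zero ∸ 1 + ∑∈ A (decr X f′) + ∣ A ∩ X ∣) ≡⟨ cong suc (+-assoc (f zero ∸ 1) _ _) ⟩
  suc (f zero ∸ 1) + rest                         ≡⟨ cong (_+ rest) (suc-pred (f zero) {{>-nonZero (pos zero here here)}}) ⟩
  f zero + rest                                   ≡⟨ cong (f zero +_) ih ⟩
  f zero + ∑∈ A f′                                ∎
  where open ≡-Reasoning; f′ = f ∘ suc; rest = ∑∈ A (decr X f′) + ∣ A ∩ X ∣
∑-decr (inside  ∷ A) (outside ∷ X) f pos | ih = trans (+-assoc (f zero) _ _) (cong (f zero +_) ih)
∑-decr (outside ∷ A) (inside  ∷ X) f pos | ih = ih
∑-decr (outside ∷ A) (outside ∷ X) f pos | ih = ih

∑-decr-⁅⁆ : ∀ {k} (X : Subset k) x f → 0 < f x → ∑∈ X (decr ⁅ x ⁆ f) + 𝟙[ x ∈? X ] ≡ ∑∈ X f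
∑-decr-⁅⁆ X x f fx>0 = trans (cong (∑∈ X (decr ⁅ x ⁆ f) +_) (sym (∣p∩⁅x⁆∣≡𝟙[x∈p] X x)))
                             (∑-decr X ⁅ x ⁆ f λ v _ v∈⁅x⁆ → subst (λ u → 0 < f u) (sym (x∈⁅y⁆⇒x≡y x v∈⁅x⁆)) fx>0)

edgeCount : ∀ {k} → List (Subset k) → Subset k → ℕ
edgeCount es X = length (filter (_⊆? X) es)

edgeCount-∷ : ∀ {k} (e : Subset k) es X → edgeCount (e ∷ es) X ≡ 𝟙[ e ⊆? X ] + edgeCount es X
edgeCount-∷ e es X with e ⊆? X
... | yes _ = refl
... | no  _ = refl

𝟙⊆-supermodular : ∀ {k} (e X Y : Subset k) → 𝟙[ e ⊆? X ] + 𝟙[ e ⊆? Y ] ≤ 𝟙[ e ⊆? X ∪ Y ] + 𝟙[ e ⊆? X ∩ Y ]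
𝟙⊆-supermodular e X Y with e ⊆? X | e ⊆? Y
... | yes e⊆X | yes e⊆Y = ≤-reflexive (sym (cong₂ _+_ (𝟙-yes (e ⊆? X ∪ Y) (p⊆p∪q Y ∘ e⊆X))
                                                     (𝟙-yes (e ⊆? X ∩ Y) (λ v∈e → x∈p∩q⁺ (e⊆X v∈e , e⊆Y v∈e)))))
... | yes e⊆X | no  _   = ≤-trans (≤-reflexive (sym (𝟙-yes (e ⊆? X ∪ Y) (p⊆p∪q Y ∘ e⊆X)))) (m≤m+n _ _)
... | no  _   | yes e⊆Y = ≤-trans (≤-reflexive (sym (𝟙-yes (e ⊆? X ∪ Y) (q⊆p∪q X Y ∘ e⊆Y)))) (m≤m+n _ _)
... | no  _   | no  _   = z≤n

edgeCount-supermodular : ∀ {k} (es : List (Subset k)) X Y →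
  edgeCount es X + edgeCount es Y ≤ edgeCount es (X ∪ Y) + edgeCount es (X ∩ Y)
edgeCount-supermodular []       X Y = z≤n
edgeCount-supermodular (e ∷ es) X Y = begin
  edgeCount (e ∷ es) X + edgeCount (e ∷ es) Y
    ≡⟨ cong₂ _+_ (edgeCount-∷ e es X) (edgeCount-∷ e es Y) ⟩
  (𝟙[ e ⊆? X ] + edgeCount es X) + (𝟙[ e ⊆? Y ] + edgeCount es Y)
    ≡⟨ interchange 𝟙[ e ⊆? X ] _ _ _ ⟩
  (𝟙[ e ⊆? X ] + 𝟙[ e ⊆? Y ]) + (edgeCount es X + edgeCount es Y)
    ≤⟨ +-mono-≤ (𝟙⊆-supermodular e X Y) (edgeCount-supermodular es X Y) ⟩
  (𝟙[ e ⊆? X ∪ Y ] + 𝟙[ e ⊆? X ∩ Y ]) + (edgeCount es (X ∪ Y) + edgeCount es (X ∩ Y))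
    ≡⟨ interchange 𝟙[ e ⊆? X ∪ Y ] _ _ _ ⟩
  (𝟙[ e ⊆? X ∪ Y ] + edgeCount es (X ∪ Y)) + (𝟙[ e ⊆? X ∩ Y ] + edgeCount es (X ∩ Y))
    ≡⟨ cong₂ _+_ (edgeCount-∷ e es (X ∪ Y)) (edgeCount-∷ e es (X ∩ Y)) ⟨
  edgeCount (e ∷ es) (X ∪ Y) + edgeCount (e ∷ es) (X ∩ Y) ∎
  where open ≤-Reasoning

edgeCount-mono : ∀ {k} (es : List (Subset k)) {X Y} → X ⊆ Y → edgeCount es X ≤ edgeCount es Y
edgeCount-mono []       X⊆Y = z≤n
edgeCount-mono (e ∷ es) {X} {Y} X⊆Y = begin
  edgeCount (e ∷ es) X         ≡⟨ edgeCount-∷ e es X ⟩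
  𝟙[ e ⊆? X ] + edgeCount es X ≤⟨ +-mono-≤ (𝟙-mono (e ⊆? X) (e ⊆? Y) (λ e⊆X → ⊆-trans e⊆X X⊆Y))
                                           (edgeCount-mono es X⊆Y) ⟩
  𝟙[ e ⊆? Y ] + edgeCount es Y ≡⟨ edgeCount-∷ e es Y ⟨
  edgeCount (e ∷ es) Y         ∎
  where open ≤-Reasoning

edgeCount-strict : ∀ {k} (es : List (Subset k)) {X Y e} → e ∈ˡ es → e ⊆ Y → ¬ e ⊆ X → X ⊆ Y →
                   edgeCount es X < edgeCount es Y
edgeCount-strict (e ∷ es) {X} {Y} (Any.here refl) e⊆Y e⊈X X⊆Y = begin-strict
  edgeCount (e ∷ es) X         ≡⟨ edgeCount-∷ e es X ⟩
  𝟙[ e ⊆? X ] + edgeCount es X ≡⟨ cong (_+ edgeCount es X) (𝟙-no (e ⊆? X) e⊈X) ⟩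
  edgeCount es X               <⟨ s≤s (edgeCount-mono es X⊆Y) ⟩
  1 + edgeCount es Y           ≡⟨ cong (_+ edgeCount es Y) (𝟙-yes (e ⊆? Y) e⊆Y) ⟨
  𝟙[ e ⊆? Y ] + edgeCount es Y ≡⟨ edgeCount-∷ e es Y ⟨
  edgeCount (e ∷ es) Y         ∎
  where open ≤-Reasoning
edgeCount-strict (e′ ∷ es) {X} {Y} (Any.there e∈es) e⊆Y e⊈X X⊆Y = begin-strict
  edgeCount (e′ ∷ es) X          ≡⟨ edgeCount-∷ e′ es X ⟩
  𝟙[ e′ ⊆? X ] + edgeCount es X  <⟨ +-mono-≤-< (𝟙-mono (e′ ⊆? X) (e′ ⊆? Y) (λ e⊆X → ⊆-trans e⊆X X⊆Y))
                                                (edgeCount-strict es e∈es e⊆Y e⊈X X⊆Y) ⟩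
  𝟙[ e′ ⊆? Y ] + edgeCount es Y  ≡⟨ edgeCount-∷ e′ es Y ⟨
  edgeCount (e′ ∷ es) Y          ∎
  where open ≤-Reasoning

∑-incidence : ∀ {k} (es : List (Subset k)) A → All (λ e → ∣ e ∣ ≤ 2) es →
              ∑[ v ∈ A ] edgeCount (filter (v ∈?_) es) A ≤ 2 * edgeCount es A
∑-incidence []       A []                   = ≤-reflexive (∑-const A 0)
∑-incidence (e ∷ es) A (∣e∣≤2 ∷ ∣es∣≤2) with e ⊆? A
... | yes e⊆A = begin
  ∑[ v ∈ A ] edgeCount (filter (v ∈?_) (e ∷ es)) A
    ≤⟨ ∑-mono A (λ v _ → through v) ⟩
  ∑[ v ∈ A ] (𝟙[ v ∈? e ] + edgeCount (filter (v ∈?_) es) A)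
    ≡⟨ ∑-+ A _ _ ⟩
  ∑[ v ∈ A ] 𝟙[ v ∈? e ] + ∑[ v ∈ A ] edgeCount (filter (v ∈?_) es) A
    ≤⟨ +-mono-≤ (≤-trans (∑-𝟙∈ A e) ∣e∣≤2) (∑-incidence es A ∣es∣≤2) ⟩
  2 + 2 * edgeCount es A
    ≡⟨ *-suc 2 _ ⟨
  2 * suc (edgeCount es A) ∎
  where
    open ≤-Reasoning
    through : ∀ v → edgeCount (filter (v ∈?_) (e ∷ es)) A ≤ 𝟙[ v ∈? e ] + edgeCount (filter (v ∈?_) es) A
    through v with v ∈? e
    ... | yes _ = ≤-reflexive (trans (edgeCount-∷ e _ A) (cong (_+ _) (𝟙-yes (e ⊆? A) e⊆A)))
    ... | no  _ = ≤-refl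
... | no e⊈A = ≤-trans (∑-mono A (λ v _ → away v)) (∑-incidence es A ∣es∣≤2)
  where
    away : ∀ v → edgeCount (filter (v ∈?_) (e ∷ es)) A ≤ edgeCount (filter (v ∈?_) es) A
    away v with v ∈? e
    ... | yes _ = ≤-reflexive (trans (edgeCount-∷ e _ A) (cong (_+ _) (𝟙-no (e ⊆? A) e⊈A)))
    ... | no  _ = ≤-refl

load : ∀ {k} → List (Fin k) → Subset k → ℕ
load os X = length (filter (_∈? X) os)

load-∷ : ∀ {k} (x : Fin k) os X → load (x ∷ os) X ≡ 𝟙[ x ∈? X ] + load os X
load-∷ x os X with x ∈? X
... | yes _ = refl
... | no  _ = refl

-- Orientations of bounded load

module _ {k : ℕ} where

  Sparse : List (Subset k) → (Fin k → ℕ) → Set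
  Sparse es c = ∀ X → edgeCount es X ≤ ∑∈ X c

  Tight : List (Subset k) → (Fin k → ℕ) → Subset k → Set
  Tight es c T = ∑∈ T c ≤ edgeCount es T

  -- At X = ⁅ v ⁆ the load bound says that v owns at most c v edges.
  Orientation : List (Subset k) → (Fin k → ℕ) → Set
  Orientation es c = Σ (List (Fin k)) λ owners → Pointwise _∈_ owners es × (∀ X → load owners X ≤ ∑∈ X c)

  tight∋? : ∀ es c x → Dec (∃ λ T → x ∈ T × Tight es c T)
  tight∋? es c x = anySubset? (λ T → x ∈? T ×-dec ∑∈ T c ≤? edgeCount es T)

  tight-∪ : ∀ es c {X Y} → Sparse es c → Tight es c X → Tight es c Y → Tight es c (X ∪ Y)
  tight-∪ es c {X} {Y} sparse tX tY = +-cancelʳ-≤ (∑∈ (X ∩ Y) c) _ _ (begin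
    ∑∈ (X ∪ Y) c + ∑∈ (X ∩ Y) c                 ≡⟨ ∑-∪-∩ X Y c ⟩
    ∑∈ X c + ∑∈ Y c                             ≤⟨ +-mono-≤ tX tY ⟩
    edgeCount es X + edgeCount es Y             ≤⟨ edgeCount-supermodular es X Y ⟩
    edgeCount es (X ∪ Y) + edgeCount es (X ∩ Y) ≤⟨ +-monoʳ-≤ _ (sparse (X ∩ Y)) ⟩
    edgeCount es (X ∪ Y) + ∑∈ (X ∩ Y) c         ∎)
    where open ≤-Reasoning

  tight-cover : ∀ es c (e : Subset k) → Sparse es c → (∀ x → x ∈ e → ∃ λ T → x ∈ T × Tight es c T) →
                ∃ λ T → e ⊆ T × Tight es c T
  tight-cover es c e sparse tightAt =
    let (T , covers , tT) = cover (allFin k) in T , (λ x∈e → covers (∈-allFin _) x∈e) , tT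
    where
    cover : ∀ xs → ∃ λ T → (∀ {x} → x ∈ˡ xs → x ∈ e → x ∈ T) × Tight es c T
    cover []       = ⊥ , (λ ()) , ≤-trans (≤-reflexive (∑-⊥ c)) z≤n
    cover (x ∷ xs) with cover xs | x ∈? e
    ... | T , covers , tT | no x∉e =
      T , (λ { (Any.here refl) x∈e → ⊥-elim (x∉e x∈e) ; (Any.there y∈xs) → covers y∈xs }) , tT
    ... | T , covers , tT | yes x∈e with tightAt x x∈e
    ...   | Tₓ , x∈Tₓ , tTₓ =
      T ∪ Tₓ , (λ { (Any.here refl) _ → q⊆p∪q T Tₓ x∈Tₓ ; (Any.there y∈xs) y∈e → p⊆p∪q Tₓ (covers y∈xs y∈e) }) ,
      tight-∪ es c sparse tT tTₓ

  release : ∀ es c x → Sparse es c → ¬ (∃ λ T → x ∈ T × Tight es c T) → 0 < c x × Sparse es (decr ⁅ x ⁆ c)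
  release es c x sparse noTight = positive , sparse′
    where
    positive : 0 < c x
    positive = n≢0⇒n>0 λ cx≡0 → noTight (⁅ x ⁆ , x∈⁅x⁆ x , ≤-trans (≤-reflexive (trans (∑-⁅⁆ x c) cx≡0)) z≤n)
    slack : ∀ X → edgeCount es X + 𝟙[ x ∈? X ] ≤ ∑∈ X c
    slack X with x ∈? X
    ... | yes x∈X = subst (_≤ ∑∈ X c) (+-comm 1 _) (≰⇒> λ tight → noTight (X , x∈X , tight))
    ... | no  _   = subst (_≤ ∑∈ X c) (sym (+-identityʳ _)) (sparse X)
    sparse′ : Sparse es (decr ⁅ x ⁆ c)
    sparse′ X = +-cancelʳ-≤ 𝟙[ x ∈? X ] _ _
      (subst (edgeCount es X + 𝟙[ x ∈? X ] ≤_) (sym (∑-decr-⁅⁆ X x c positive)) (slack X))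

  sparse-tail : ∀ e es c → Sparse (e ∷ es) c → Sparse es c
  sparse-tail e es c sparse X = ≤-trans (m≤n+m _ _) (subst (_≤ ∑∈ X c) (edgeCount-∷ e es X) (sparse X))

  sparse⇒orientable : ∀ es c → Sparse es c → Orientation es c
  sparse⇒orientable []       c sparse = [] , [] , λ X → z≤n
  sparse⇒orientable (e ∷ es) c sparse with any? (λ x → x ∈? e ×-dec ¬? (tight∋? es c x))
  ... | yes (x , x∈e , noTight) = x ∷ owners , x∈e ∷ owned , bounded
    where
    open Σ (release es c x (sparse-tail e es c sparse) noTight) renaming (proj₁ to cx>0; proj₂ to sparse′)
    open Σ (sparse⇒orientable es (decr ⁅ x ⁆ c) sparse′) renaming (proj₁ to owners; proj₂ to rest)
    owned = proj₁ rest
    bounded : ∀ X → load (x ∷ owners) X ≤ ∑∈ X c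
    bounded X = begin
      load (x ∷ owners) X                    ≡⟨ load-∷ x owners X ⟩
      𝟙[ x ∈? X ] + load owners X            ≤⟨ +-monoʳ-≤ 𝟙[ x ∈? X ] (proj₂ rest X) ⟩
      𝟙[ x ∈? X ] + ∑∈ X (decr ⁅ x ⁆ c)      ≡⟨ +-comm 𝟙[ x ∈? X ] _ ⟩
      ∑∈ X (decr ⁅ x ⁆ c) + 𝟙[ x ∈? X ]      ≡⟨ ∑-decr-⁅⁆ X x c cx>0 ⟩
      ∑∈ X c                                 ∎
      where open ≤-Reasoning
  ... | no noneFree with tight-cover es c e (sparse-tail e es c sparse) tightAt
    where
    tightAt : ∀ x → x ∈ e → ∃ λ T → x ∈ T × Tight es c T
    tightAt x x∈e = decidable-stable (tight∋? es c x) λ noTight → noneFree (x , x∈e , noTight)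
  ... | T , e⊆T , tight = ⊥-elim (1+n≰n (begin
      suc (edgeCount es T)          ≡⟨ cong (_+ edgeCount es T) (𝟙-yes (e ⊆? T) e⊆T) ⟨
      𝟙[ e ⊆? T ] + edgeCount es T  ≡⟨ edgeCount-∷ e es T ⟨
      edgeCount (e ∷ es) T          ≤⟨ sparse T ⟩
      ∑∈ T c                        ≤⟨ tight ⟩
      edgeCount es T                ∎))
    where open ≤-Reasoning

-- Painting degenerate hypergraphs

decr-∈ : ∀ {m} {X : Subset m} {v} f → v ∈ X → decr X f v ≡ f v ∸ 1
decr-∈ f here = refl
decr-∈ {X = inside  ∷ _} f (there v∈X) = decr-∈ (f ∘ suc) v∈X
decr-∈ {X = outside ∷ _} f (there v∈X) = decr-∈ (f ∘ suc) v∈X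

decr-∉ : ∀ {m} (X : Subset m) {v} f → v ∉ X → decr X f v ≡ f v
decr-∉ (inside  ∷ X) {zero}  f v∉X = ⊥-elim (v∉X here)
decr-∉ (outside ∷ X) {zero}  f v∉X = refl
decr-∉ (inside  ∷ X) {suc v} f v∉X = decr-∉ X (f ∘ suc) (v∉X ∘ there)
decr-∉ (outside ∷ X) {suc v} f v∉X = decr-∉ X (f ∘ suc) (v∉X ∘ there)

decr-agree : ∀ {m} (X Y : Subset m) {f g : Fin m → ℕ} {v} → (v ∈ X → v ∈ Y) → (v ∈ Y → v ∈ X) → f v ≡ g v →
             decr X f v ≡ decr Y g v
decr-agree X Y {f} {g} {v} X→Y Y→X fv≡gv with v ∈? X
... | yes v∈X = trans (decr-∈ f v∈X) (trans (cong (_∸ 1) fv≡gv) (sym (decr-∈ g (X→Y v∈X))))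
... | no  v∉X = trans (decr-∉ X f v∉X) (trans fv≡gv (sym (decr-∉ Y g (v∉X ∘ Y→X))))

deg : (H : Hypergraph) → Subset (n H) → Fin (n H) → ℕ
deg H A v = edgeCount (filter (v ∈?_) (edges H)) A

Answer : (H : Hypergraph) → Subset (n H) → (Fin (n H) → ℕ) → Subset (n H) → Set
Answer H A f X = Σ (Subset (n H)) λ X′ → X′ ⊆ X × Independent H X′ × Paintable H (A ─ X′) (decr X f)

module _ (H : Hypergraph) where

  edge≥2 : ∀ {e} → e ∈ˡ edges H → 2 ≤ ∣ e ∣
  edge≥2 = All.lookup (edges≥2 H)

  Paintable-cong : ∀ {A f g} → (∀ v → v ∈ A → f v ≡ g v) → Paintable H A f → Paintable H A g
  Paintable-cong {A} {f} {g} f≗g (paint pos moves) =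
    paint (λ v v∈A → subst (0 <_) (f≗g v v∈A) (pos v v∈A)) (λ X X⊆A ne → answer X (moves X X⊆A ne))
    where
    answer : ∀ X → Answer H A f X → Answer H A g X
    answer X (X′ , X′⊆X , indep , P) =
      X′ , X′⊆X , indep , Paintable-cong (λ v v∈ → decr-agree X X id id (f≗g v (p─q⊆p A X′ v∈))) P

  singleton-independent : ∀ v → Independent H ⁅ v ⁆
  singleton-independent v e e∈ e⊆⁅v⁆ =
    let (u , u∈e , u≢v) = other-vertex e v (edge≥2 e∈) in u≢v (x∈⁅y⁆⇒x≡y v (e⊆⁅v⁆ u∈e))

  deg-mono : ∀ {A′ A} v → A′ ⊆ A → deg H A′ v ≤ deg H A v
  deg-mono v = edgeCount-mono (filter (v ∈?_) (edges H))

  deg-strict : ∀ {A′ A e v} → e ∈ˡ edges H → v ∈ e → e ⊆ A → ¬ e ⊆ A′ → A′ ⊆ A → deg H A′ v < deg H A v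
  deg-strict {v = v} e∈ v∈e = edgeCount-strict (filter (v ∈?_) (edges H)) (∈-filter⁺ (v ∈?_) e∈ v∈e)

  deg-drops : ∀ {A X′ e v} → e ∈ˡ edges H → v ∈ e → e ⊆ A → e ⊆ X′ ∪ ⁅ v ⁆ → deg H (A ─ X′) v < deg H A v
  deg-drops {A} {X′} {e} {v} e∈ v∈e e⊆A e⊆X′+v = deg-strict e∈ v∈e e⊆A e⊈A─X′ (p─q⊆p A X′)
    where
    e⊈A─X′ : ¬ e ⊆ A ─ X′
    e⊈A─X′ e⊆ with other-vertex e v (edge≥2 e∈)
    ... | u , u∈e , u≢v with x∈p∪q⁻ X′ ⁅ v ⁆ (e⊆X′+v u∈e)
    ...   | inj₁ u∈X′  = x∈p─q⇒x∉q (e⊆ u∈e) u∈X′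
    ...   | inj₂ u∈⁅v⁆ = u≢v (x∈⁅y⁆⇒x≡y v u∈⁅v⁆)

  independent-∪⁅⁆ : ∀ {X′ v} → Independent H X′ → ¬ Any (λ e → v ∈ e × e ⊆ X′ ∪ ⁅ v ⁆) (edges H) →
                    Independent H (X′ ∪ ⁅ v ⁆)
  independent-∪⁅⁆ {X′} {v} indep unblocked e e∈ e⊆ with v ∈? e
  ... | yes v∈e = unblocked (lose e∈ (v∈e , e⊆))
  ... | no  v∉e = indep e e∈ λ u∈e → [ id , (λ u∈⁅v⁆ → ⊥-elim (v∉e (subst (_∈ e) (x∈⁅y⁆⇒x≡y v u∈⁅v⁆) u∈e))) ]
                                        (x∈p∪q⁻ X′ ⁅ v ⁆ (e⊆ u∈e))

  -- A marked v joins the painter's answer unless that would complete an edge through v; each such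
  -- refusal costs v a token, but also removes that edge from deg H · v for good.
  add-vertex : ∀ {B g} → Paintable H B g → ∀ {A f v} → B ≡ A - v → v ∈ A → (∀ u → u ∈ B → g u ≡ f u) →
               deg H A v < f v → Paintable H A f
  add-vertex {g = g} (paint posB movesB) {A} {f} {v} refl v∈A g≗f small = paint pos moves
    where
    ≢v : ∀ {u} → u ∈ A - v → u ≢ v
    ≢v u∈ refl = x∈p─q⇒x∉q u∈ (x∈⁅x⁆ v)

    pos : ∀ u → u ∈ A → 0 < f u
    pos u u∈A with u ≟ v
    ... | yes refl = ≤-<-trans z≤n small
    ... | no  u≢v  = subst (0 <_) (g≗f u (x∈p∧x≢y⇒x∈p-y u∈A u≢v)) (posB u (x∈p∧x≢y⇒x∈p-y u∈A u≢v))

    avoiding : ∀ X → X ⊆ A → Nonempty X → v ∉ X → Answer H A f X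
    avoiding X X⊆A neX v∉X with movesB X (λ u∈X → x∈p∧x≢y⇒x∈p-y (X⊆A u∈X) λ { refl → v∉X u∈X }) neX
    ... | X′ , X′⊆X , indep , P′ = X′ , X′⊆X , indep ,
      add-vertex P′ (p─q─r≡p─r─q A ⁅ v ⁆ X′) (x∈p∧x∉q⇒x∈p─q v∈A (v∉X ∘ X′⊆X))
        (λ u u∈ → decr-agree X X id id (g≗f u (p─q⊆p _ X′ u∈)))
        (subst (deg H (A ─ X′) v <_) (sym (decr-∉ X f v∉X)) (≤-<-trans (deg-mono v (p─q⊆p A X′)) small))

    alone : ∀ X → v ∈ X → ¬ Nonempty (X - v) → Answer H A f X
    alone X v∈X noOther = ⁅ v ⁆ , (λ u∈⁅v⁆ → subst (_∈ X) (sym (x∈⁅y⁆⇒x≡y v u∈⁅v⁆)) v∈X) , singleton-independent v ,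
      Paintable-cong (λ u u∈ → trans (g≗f u u∈) (sym (decr-∉ X f λ u∈X → noOther (u , x∈p∧x≢y⇒x∈p-y u∈X (≢v u∈)))))
                     (paint posB movesB)

    agree : ∀ X X′ u → u ∈ (A - v) ─ X′ → decr (X - v) g u ≡ decr X f u
    agree X X′ u u∈ = decr-agree (X - v) X (p─q⊆p X ⁅ v ⁆) (λ u∈X → x∈p∧x≢y⇒x∈p-y u∈X (≢v u∈A-v))
                                 (g≗f u u∈A-v)
      where u∈A-v = p─q⊆p _ X′ u∈

    including : ∀ X → X ⊆ A → v ∈ X → Nonempty (X - v) → Answer H A f X
    including X X⊆A v∈X neX-v with movesB (X - v) (p⊆q⇒p─r⊆q─r ⁅ v ⁆ X⊆A) neX-v
    ... | X′ , X′⊆X-v , indep , P′ with Any.any? (λ e → v ∈? e ×-dec e ⊆? X′ ∪ ⁅ v ⁆) (edges H)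
    ...   | yes blocking = X′ , X′⊆X , indep , add-vertex P′ (p─q─r≡p─r─q A ⁅ v ⁆ X′) v∈A─X′ (agree X X′) smaller
      where
      X′⊆X = ⊆-trans X′⊆X-v (p─q⊆p X ⁅ v ⁆)
      v∈A─X′ = x∈p∧x∉q⇒x∈p─q v∈A λ v∈X′ → x∈p─q⇒x∉q (X′⊆X-v v∈X′) (x∈⁅x⁆ v)
      smaller : deg H (A ─ X′) v < decr X f v
      smaller with find blocking
      ... | e , e∈ , v∈e , e⊆X′+v = subst (deg H (A ─ X′) v <_) (sym (decr-∈ f v∈X)) (∸-monoˡ-≤ 1 (≤-trans (s≤s
              (deg-drops e∈ v∈e (⊆-trans e⊆X′+v (p⊆r⇒x∈r⇒p∪⁅x⁆⊆r (⊆-trans X′⊆X X⊆A) v∈A)) e⊆X′+v)) small))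
    ...   | no unblocked = X′ ∪ ⁅ v ⁆ , p⊆r⇒x∈r⇒p∪⁅x⁆⊆r (⊆-trans X′⊆X-v (p─q⊆p X ⁅ v ⁆)) v∈X ,
      independent-∪⁅⁆ indep unblocked ,
      subst (λ S → Paintable H S (decr X f)) (trans (p─q─r≡p─q∪r A ⁅ v ⁆ X′) (cong (A ─_) (∪-comm ⁅ v ⁆ X′)))
            (Paintable-cong (agree X X′) P′)

    moves : ∀ X → X ⊆ A → Nonempty X → Answer H A f X
    moves X X⊆A neX with v ∈? X
    ... | no  v∉X = avoiding X X⊆A neX v∉X
    ... | yes v∈X with nonempty? (X - v)
    ...   | no  noOther = alone X v∈X noOther
    ...   | yes neX-v   = including X X⊆A v∈X neX-v

  Degenerate : ℕ → Set
  Degenerate k = ∀ A → Nonempty A → ∃ λ v → v ∈ A × deg H A v < k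

  degenerate⇒paintable : ∀ {k} → Degenerate k → KPaintable H k
  degenerate⇒paintable {k} degenerate = paintable (n H) ⊤ (∣p∣≤n ⊤)
    where
    paintable : ∀ s A → ∣ A ∣ ≤ s → Paintable H A (λ _ → k)
    paintable s A ∣A∣≤s with nonempty? A
    ... | no empty = paint (λ v v∈A → ⊥-elim (empty (v , v∈A))) (λ X X⊆A (u , u∈X) → ⊥-elim (empty (u , X⊆A u∈X)))
    paintable zero    A ∣A∣≤0 | yes (u , u∈A) = ⊥-elim (<⇒≱ (x∈p⇒0<∣p∣ u∈A) ∣A∣≤0)
    paintable (suc s) A ∣A∣≤s | yes neA with degenerate A neA
    ... | v , v∈A , small =
      add-vertex (paintable s (A - v) (≤-pred (≤-trans (x∈p⇒∣p-x∣<∣p∣ v∈A) ∣A∣≤s))) refl v∈A (λ _ _ → refl) small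

  Paintable-refine : ∀ (es : List (Subset (n H))) es≥2 → (∀ e → e ∈ˡ edges H → ∃ λ e′ → e′ ∈ˡ es × e′ ⊆ e) → ∀ {A f} →
                     Paintable (record { n = n H ; edges = es ; edges≥2 = es≥2 }) A f → Paintable H A f
  Paintable-refine es es≥2 refines (paint pos moves) = paint pos λ X X⊆A ne → answer (moves X X⊆A ne)
    where
    answer : ∀ {A f X} → Answer (record { n = n H ; edges = es ; edges≥2 = es≥2 }) A f X → Answer H A f X
    answer (X′ , X′⊆X , indep , P) = X′ , X′⊆X , independent , Paintable-refine es es≥2 refines P
      where
      independent : Independent H X′
      independent e e∈ e⊆X′ = let (e′ , e′∈ , e′⊆e) = refines e e∈ in indep e′ e′∈ (⊆-trans e′⊆e e⊆X′)

-- Pair graphs and the density bound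

module _ {k : ℕ} where

  pairs : ∀ {owners : List (Fin k)} {es} → Pointwise _∈_ owners es → All (λ e → 2 ≤ ∣ e ∣) es → List (Subset k)
  pairs []                                   []             = []
  pairs {owners = a ∷ _} {e ∷ _} (_ ∷ owned) (∣e∣≥2 ∷ es≥2) =
    ⁅ a ⁆ ∪ ⁅ proj₁ (other-vertex e a ∣e∣≥2) ⁆ ∷ pairs owned es≥2

  pairs≥2 : ∀ {owners es} (owned : Pointwise _∈_ owners es) es≥2 → All (λ p → 2 ≤ ∣ p ∣) (pairs owned es≥2)
  pairs≥2 []          []             = []
  pairs≥2 {a ∷ _} {e ∷ _} (_ ∷ owned) (∣e∣≥2 ∷ es≥2) =
    ∣pair∣≥2 (proj₂ (proj₂ (other-vertex e a ∣e∣≥2))) ∷ pairs≥2 owned es≥2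

  pairs≤2 : ∀ {owners es} (owned : Pointwise _∈_ owners es) es≥2 → All (λ p → ∣ p ∣ ≤ 2) (pairs owned es≥2)
  pairs≤2 []          []             = []
  pairs≤2 {a ∷ _} {e ∷ _} (_ ∷ owned) (∣e∣≥2 ∷ es≥2) = ∣pair∣≤2 a _ ∷ pairs≤2 owned es≥2

  pairs-refine : ∀ {owners es} (owned : Pointwise _∈_ owners es) es≥2 {e} → e ∈ˡ es →
                 ∃ λ p → p ∈ˡ pairs owned es≥2 × p ⊆ e
  pairs-refine {a ∷ _} {e ∷ _} (a∈e ∷ owned) (∣e∣≥2 ∷ es≥2) (Any.here refl) =
    _ , Any.here refl , p⊆r⇒x∈r⇒p∪⁅x⁆⊆r (λ u∈⁅a⁆ → subst (_∈ e) (sym (x∈⁅y⁆⇒x≡y a u∈⁅a⁆)) a∈e)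
                                         (proj₁ (proj₂ (other-vertex e a ∣e∣≥2)))
  pairs-refine (_ ∷ owned) (_ ∷ es≥2) (Any.there e∈) =
    let (p , p∈ , p⊆e) = pairs-refine owned es≥2 e∈ in p , Any.there p∈ , p⊆e

  edgeCount-pairs : ∀ {owners es} (owned : Pointwise _∈_ owners es) es≥2 A →
                    edgeCount (pairs owned es≥2) A ≤ load owners A
  edgeCount-pairs []          []             A = z≤n
  edgeCount-pairs {a ∷ os} {e ∷ _} (_ ∷ owned) (∣e∣≥2 ∷ es≥2) A = begin
    edgeCount (p ∷ pairs owned es≥2) A         ≡⟨ edgeCount-∷ p _ A ⟩
    𝟙[ p ⊆? A ] + edgeCount (pairs owned es≥2) A ≤⟨ +-mono-≤ (𝟙-mono (p ⊆? A) (a ∈? A) (λ p⊆A → p⊆A (p⊆p∪q _ (x∈⁅x⁆ a))))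
                                                            (edgeCount-pairs owned es≥2 A) ⟩
    𝟙[ a ∈? A ] + load os A                    ≡⟨ load-∷ a os A ⟨
    load (a ∷ os) A                            ∎
    where
    open ≤-Reasoning
    p = ⁅ a ⁆ ∪ ⁅ proj₁ (other-vertex e a ∣e∣≥2) ⁆

orientable⇒paintable : ∀ (H : Hypergraph) d {owners} → Pointwise _∈_ owners (edges H) →
                       (∀ X → load owners X ≤ ∑[ _ ∈ X ] d) → KPaintable H (2 * d + 1)
orientable⇒paintable H d {owners} owned light =
  Paintable-refine H (edges G) (edges≥2 G) (λ e → pairs-refine owned (edges≥2 H)) (degenerate⇒paintable G degenerate)
  where
  G : Hypergraph
  G = record { n = n H ; edges = pairs owned (edges≥2 H) ; edges≥2 = pairs≥2 owned (edges≥2 H) }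
  degenerate : Degenerate G (2 * d + 1)
  degenerate A neA = let (v , v∈A , deg≤2d) = ∑-average A (deg G A) (2 * d) neA ∑deg≤ in
    v , v∈A , subst (deg G A v <_) (+-comm 1 (2 * d)) (s≤s deg≤2d)
    where
    open ≤-Reasoning
    ∑deg≤ : ∑∈ A (deg G A) ≤ 2 * d * ∣ A ∣
    ∑deg≤ = begin
      ∑∈ A (deg G A)              ≤⟨ ∑-incidence (edges G) A (pairs≤2 owned (edges≥2 H)) ⟩
      2 * edgeCount (edges G) A   ≤⟨ *-monoʳ-≤ 2 (edgeCount-pairs owned (edges≥2 H) A) ⟩
      2 * load owners A           ≤⟨ *-monoʳ-≤ 2 (light A) ⟩
      2 * ∑[ _ ∈ A ] d            ≡⟨ cong (2 *_) (∑-const A d) ⟩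
      2 * (d * ∣ A ∣)             ≡⟨ *-assoc 2 d ∣ A ∣ ⟨
      2 * d * ∣ A ∣               ∎

≤-ceilDiv : ∀ a m → a ≤ ceilDiv a (suc m) * suc m
≤-ceilDiv a m = +-cancelʳ-≤ m a _ (begin
  a + m                                       ≡⟨ m≡m%n+[m/n]*n (a + m) (suc m) ⟩
  (a + m) % suc m + (a + m) / suc m * suc m   ≤⟨ +-monoˡ-≤ _ (≤-pred (m%n<n (a + m) (suc m))) ⟩
  m + (a + m) / suc m * suc m                 ≡⟨ +-comm m _ ⟩
  (a + m) / suc m * suc m + m                 ∎)
  where open ≤-Reasoning

∈-allSubsets : ∀ {m} (X : Subset m) → X ∈ˡ allSubsets m
∈-allSubsets []            = Any.here refl
∈-allSubsets (inside  ∷ X) = ∈-++⁺ˡ (∈-map⁺ (inside ∷_) (∈-allSubsets X))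
∈-allSubsets (outside ∷ X) = ∈-++⁺ʳ (map (inside ∷_) (allSubsets _)) (∈-map⁺ (outside ∷_) (∈-allSubsets X))

≤-foldr-⊔ : ∀ {A : Set} (g : A → ℕ) {x xs} → x ∈ˡ xs → g x ≤ foldr (λ y r → g y ⊔ r) 0 xs
≤-foldr-⊔ g (Any.here refl)  = m≤m⊔n _ _
≤-foldr-⊔ g {xs = y ∷ _} (Any.there x∈) = ≤-trans (≤-foldr-⊔ g x∈) (m≤n⊔m (g y) _)

-- ceilDiv a 0 is 0 rather than a ceiling, but when ∣ X ∣ = 0 no edge fits in X anyway.
edgesIn≤ceilEd : ∀ H X → edgesIn H X ≤ ceilEd H * ∣ X ∣
edgesIn≤ceilEd H X with ∣ X ∣ in ∣X∣≡
... | zero  = ≤-trans (≤-reflexive (cong length (filter-none (_⊆? X) (All.map too-big (edges≥2 H))))) z≤n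
  where
  too-big : ∀ {e} → 2 ≤ ∣ e ∣ → ¬ e ⊆ X
  too-big ∣e∣≥2 e⊆X = <⇒≱ (≤-trans (s≤s z≤n) ∣e∣≥2) (≤-trans (p⊆q⇒∣p∣≤∣q∣ e⊆X) (≤-reflexive ∣X∣≡))
... | suc m = ≤-trans (≤-ceilDiv (edgesIn H X) m) (*-monoˡ-≤ (suc m)
                (subst (λ s → ceilDiv (edgesIn H X) s ≤ ceilEd H) ∣X∣≡
                       (≤-foldr-⊔ (λ Y → ceilDiv (edgesIn H Y) ∣ Y ∣) (∈-allSubsets X))))

paintable-2ed+1 : ∀ H → KPaintable H (2 * ceilEd H + 1)
paintable-2ed+1 H = orientable⇒paintable H (ceilEd H) (proj₁ (proj₂ oriented)) (proj₂ (proj₂ oriented))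
  where
  oriented = sparse⇒orientable (edges H) (λ _ → ceilEd H) λ X →
    subst (edgesIn H X ≤_) (sym (∑-const X (ceilEd H))) (edgesIn≤ceilEd H X)

-- List colourings from painting strategies

_≢?_ : (x y : ℕ) → Dec (x ≢ y)
x ≢? y = ¬? (x ℕ.≟ y)

remove : ℕ → List ℕ → List ℕ
remove c = filter (_≢? c)

∈-remove⁻ : ∀ c {x} xs → x ∈ˡ remove c xs → x ∈ˡ xs × x ≢ c
∈-remove⁻ c xs = ∈-filter⁻ (_≢? c) {xs = xs}

length-remove : ∀ c {xs} → Unique xs → length xs ≤ suc (length (remove c xs))
length-remove c {[]}     []                = z≤n
length-remove c {x ∷ xs} (x∉xs ∷ unique) with x ℕ.≟ c
... | yes refl = s≤s (≤-reflexive (cong length (sym (trans (filter-reject (_≢? c) (λ c≢c → c≢c refl))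
                   (filter-all (_≢? c) (All.map (λ c≢y y≡c → c≢y (sym y≡c)) x∉xs))))))
... | no  x≢c  = ≤-trans (s≤s (length-remove c unique))
                         (≤-reflexive (cong (suc ∘ length) (sym (filter-accept (_≢? c) x≢c))))

some-element : ∀ {A : Set} (xs : List A) → 0 < length xs → ∃ λ x → x ∈ˡ xs
some-element (x ∷ _) _ = x , Any.here refl

module _ (H : Hypergraph) where

  ListColouring : (Fin (n H) → List ℕ) → Subset (n H) → Set
  ListColouring L A =
    Σ (Fin (n H) → ℕ) λ c → (∀ v → v ∈ A → c v ∈ˡ L v) × (∀ e → e ∈ˡ edges H → e ⊆ A → ¬ Monochromatic c e)

  add-colour-class : ∀ {L A X′} c → (∀ {v} → v ∈ X′ → v ∈ A × c ∈ˡ L v) → Independent H X′ →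
                     ListColouring (remove c ∘ L) (A ─ X′) → ListColouring L A
  add-colour-class {L} {A} {X′} c X′-coloured indep (col′ , col′∈ , proper′) = col , col∈ , proper
    where
    col : Fin (n H) → ℕ
    col v with v ∈? X′
    ... | yes _ = c
    ... | no  _ = col′ v
    col∈ : ∀ v → v ∈ A → col v ∈ˡ L v
    col∈ v v∈A with v ∈? X′
    ... | yes v∈X′ = proj₂ (X′-coloured v∈X′)
    ... | no  v∉X′ = proj₁ (∈-remove⁻ c (L v) (col′∈ v (x∈p∧x∉q⇒x∈p─q v∈A v∉X′)))
    proper : ∀ e → e ∈ˡ edges H → e ⊆ A → ¬ Monochromatic col e
    proper e e∈ e⊆A (a , mono) with a ℕ.≟ c
    ... | yes refl = indep e e∈ e⊆X′
      where
      e⊆X′ : e ⊆ X′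
      e⊆X′ {v} v∈e with v ∈? X′ | mono v v∈e
      ... | yes v∈X′ | _      = v∈X′
      ... | no  v∉X′ | col′≡c = ⊥-elim (
        proj₂ (∈-remove⁻ c (L v) (col′∈ v (x∈p∧x∉q⇒x∈p─q (e⊆A v∈e) v∉X′))) col′≡c)
    ... | no a≢c = proper′ e e∈ e⊆A─X′ (a , mono′)
      where
      ∉X′ : ∀ {v} → v ∈ e → v ∉ X′
      ∉X′ {v} v∈e v∈X′ with v ∈? X′ | mono v v∈e
      ... | yes _    | c≡a = a≢c (sym c≡a)
      ... | no  v∉X′ | _   = v∉X′ v∈X′
      e⊆A─X′ : e ⊆ A ─ X′
      e⊆A─X′ v∈e = x∈p∧x∉q⇒x∈p─q (e⊆A v∈e) (∉X′ v∈e)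
      mono′ : ∀ v → v ∈ e → col′ v ≡ a
      mono′ v v∈e with v ∈? X′ | mono v v∈e
      ... | yes v∈X′ | _         = ⊥-elim (∉X′ v∈e v∈X′)
      ... | no  _    | col′v≡a   = col′v≡a

  paintable⇒colourable : ∀ {A f} → Paintable H A f → ∀ L → (∀ v → v ∈ A → f v ≤ length (L v)) → (∀ v → Unique (L v)) →
                         ListColouring L A
  paintable⇒colourable {A} {f} (paint pos moves) L long unique with nonempty? A
  ... | no empty = (λ _ → 0) , (λ v v∈A → ⊥-elim (empty (v , v∈A))) , λ e e∈ e⊆A _ →
    let (u , u∈e) = 0<∣p∣⇒nonempty e (≤-trans (s≤s z≤n) (edge≥2 H e∈)) in empty (u , e⊆A u∈e)
  ... | yes (w , w∈A) = let (c , c∈Lw) = some-element (L w) (≤-trans (pos w w∈A) (long w w∈A)) in colour-with c w∈A c∈Lw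
    where
    has? : ∀ c v → Dec (v ∈ A × c ∈ˡ L v)
    has? c v = v ∈? A ×-dec c ∈ˡ? L v

    long′ : ∀ c X′ v → v ∈ A ─ X′ → decr ⟦ has? c ⟧ f v ≤ length (remove c (L v))
    long′ c X′ v v∈ with v ∈? ⟦ has? c ⟧
    ... | yes v∈X = begin
      decr ⟦ has? c ⟧ f v        ≡⟨ decr-∈ f v∈X ⟩
      f v ∸ 1                    ≤⟨ ∸-monoˡ-≤ 1 (long v (p─q⊆p A X′ v∈)) ⟩
      length (L v) ∸ 1           ≤⟨ ∸-monoˡ-≤ 1 (length-remove c (unique v)) ⟩
      length (remove c (L v))    ∎
      where open ≤-Reasoning
    ... | no v∉X = begin
      decr ⟦ has? c ⟧ f v        ≡⟨ decr-∉ ⟦ has? c ⟧ f v∉X ⟩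
      f v                        ≤⟨ long v (p─q⊆p A X′ v∈) ⟩
      length (L v)               ≡⟨ cong length (filter-all (_≢? c) (All.tabulate c∉Lv)) ⟨
      length (remove c (L v))    ∎
      where
      open ≤-Reasoning
      c∉Lv : ∀ {y} → y ∈ˡ L v → y ≢ c
      c∉Lv y∈ refl = v∉X (∈⟦⟧⁺ (has? c) (p─q⊆p A X′ v∈ , y∈))

    colour-with : ∀ c {w} → w ∈ A → c ∈ˡ L w → ListColouring L A
    colour-with c w∈A c∈Lw with moves ⟦ has? c ⟧ (proj₁ ∘ ∈⟦⟧⁻ (has? c)) (_ , ∈⟦⟧⁺ (has? c) (w∈A , c∈Lw))
    ... | X′ , X′⊆X , indep , P′ =
      add-colour-class c (∈⟦⟧⁻ (has? c) ∘ X′⊆X) indep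
        (paintable⇒colourable P′ (remove c ∘ L) (long′ c X′) (λ v → Unique.filter⁺ (_≢? c) (unique v)))

paintable⇒choosable : ∀ H k → KPaintable H k → Choosable H k
paintable⇒choosable H k P L lengths unique =
  let (c , c∈L , proper) = paintable⇒colourable H P L (λ v _ → ≤-reflexive (sym (lengths v))) unique
  in c , (λ v → c∈L v ∈⊤) , λ e e∈ → proper e e∈ ⊆⊤

-- Deciding paintability and choosability

decr-measure : ∀ {k} (A X X′ : Subset k) f → (∀ v → v ∈ A → 0 < f v) → X ⊆ A → Nonempty X →
               ∑∈ (A ─ X′) (decr X f) < ∑∈ A f
decr-measure A X X′ f pos X⊆A (w , w∈X) = begin-strict
  ∑∈ (A ─ X′) (decr X f)         ≤⟨ ∑-─ A X′ (decr X f) ⟩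
  ∑∈ A (decr X f)                <⟨ m<m+n _ (x∈p⇒0<∣p∣ (x∈p∩q⁺ (X⊆A w∈X , w∈X))) ⟩
  ∑∈ A (decr X f) + ∣ A ∩ X ∣    ≡⟨ ∑-decr A X f (λ v v∈A _ → pos v v∈A) ⟩
  ∑∈ A f                         ∎
  where open ≤-Reasoning

module _ (H : Hypergraph) where

  independent? : ∀ X → Dec (Independent H X)
  independent? X = ∀∈? (λ e → ¬? (e ⊆? X)) (edges H)

  -- The recursion terminates because every round removes at least one token from the alive vertices.
  paintable? : ∀ A f → Dec (Paintable H A f)
  paintable? A f = bounded (suc (∑∈ A f)) A f ≤-refl
    where
    bounded : ∀ N A f → ∑∈ A f < N → Dec (Paintable H A f)
    bounded (suc N) A f ∑<N with all? (λ v → v ∈? A →-dec 0 <? f v)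
    ... | no  ¬pos = no λ { (paint pos _) → ¬pos pos }
    ... | yes pos  = map′ (paint pos) (λ { (paint _ moves) → moves }) (∀-subset? answer?)
      where
      answer? : ∀ X → Dec (X ⊆ A → Nonempty X → Answer H A f X)
      answer? X with X ⊆? A | nonempty? X
      ... | no X⊈A  | _        = yes λ X⊆A → ⊥-elim (X⊈A X⊆A)
      ... | yes _   | no empty = yes λ _ ne → ⊥-elim (empty ne)
      ... | yes X⊆A | yes ne   = map′ (λ a _ _ → a) (λ a → a X⊆A ne) (anySubset? λ X′ →
        X′ ⊆? X ×-dec independent? X′ ×-dec
        bounded N (A ─ X′) (decr X f) (≤-trans (decr-measure A X X′ f pos X⊆A ne) (≤-pred ∑<N)))

  monochromatic? : ∀ c e → Dec (Monochromatic {n H} c e)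
  monochromatic? c e with nonempty? e
  ... | no  empty    = yes (0 , λ v v∈e → ⊥-elim (empty (v , v∈e)))
  ... | yes (w , w∈e) = map′ (c w ,_) (λ (a , mono) v v∈e → trans (mono v v∈e) (sym (mono w w∈e)))
                             (all? λ v → v ∈? e →-dec c v ℕ.≟ c w)

  proper? : ∀ c → Dec (Proper H c)
  proper? c = ∀∈? (λ e → ¬? (monochromatic? c e)) (edges H)

allLists : ℕ → ℕ → List (List ℕ)
allLists N zero    = [] ∷ []
allLists N (suc k) = cartesianProductWith _∷_ (upTo N) (allLists N k)

∈-allLists : ∀ N xs → All (_< N) xs → xs ∈ˡ allLists N (length xs)
∈-allLists N []       []              = Any.here refl
∈-allLists N (x ∷ xs) (x<N ∷ xs<N) = ∈-cartesianProductWith⁺ _∷_ (∈-upTo⁺ x<N) (∈-allLists N xs xs<N)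

position : ℕ → List ℕ → ℕ
position x []       = 0
position x (y ∷ ys) with x ℕ.≟ y
... | yes _ = 0
... | no  _ = suc (position x ys)

position-< : ∀ {x} ys → x ∈ˡ ys → position x ys < length ys
position-< {x} (y ∷ ys) x∈ with x ℕ.≟ y | x∈
... | yes _   | _              = s≤s z≤n
... | no  x≢y | Any.here x≡y   = ⊥-elim (x≢y x≡y)
... | no  _   | Any.there x∈ys = s≤s (position-< ys x∈ys)

position-injective : ∀ {x y} zs → x ∈ˡ zs → y ∈ˡ zs → position x zs ≡ position y zs → x ≡ y
position-injective {x} {y} (z ∷ zs) x∈ y∈ same with x ℕ.≟ z | y ℕ.≟ z
... | yes x≡z | yes y≡z = trans x≡z (sym y≡z)
position-injective (z ∷ zs) (Any.here x≡z)   _                  _    | no x≢z | _      = ⊥-elim (x≢z x≡z)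
position-injective (z ∷ zs) _                (Any.here y≡z)     _    | _      | no y≢z = ⊥-elim (y≢z y≡z)
position-injective (z ∷ zs) (Any.there x∈zs) (Any.there y∈zs) same | no _ | no _ =
  position-injective zs x∈zs y∈zs (suc-injective same)

Unique-map⁺ : ∀ {f : ℕ → ℕ} {xs} → (∀ {x y} → x ∈ˡ xs → y ∈ˡ xs → f x ≡ f y → x ≡ y) → Unique xs → Unique (map f xs)
Unique-map⁺ injective []                 = []
Unique-map⁺ injective (x∉xs ∷ unique) =
  AllP.map⁺ (All.tabulate λ y∈ fx≡fy → All.lookup x∉xs y∈ (injective (Any.here refl) (Any.there y∈) fx≡fy))
  ∷ Unique-map⁺ (λ x∈ y∈ → injective (Any.there x∈) (Any.there y∈)) unique

allColours : ∀ {n} → (Fin n → List ℕ) → List ℕ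
allColours {zero}  L = []
allColours {suc n} L = L zero ++ allColours (L ∘ suc)

length-allColours : ∀ {n k} (L : Fin n → List ℕ) → (∀ v → length (L v) ≡ k) → length (allColours L) ≡ n * k
length-allColours {zero}  L lengths = refl
length-allColours {suc n} L lengths =
  trans (length-++ (L zero)) (cong₂ _+_ (lengths zero) (length-allColours (L ∘ suc) (lengths ∘ suc)))

∈-allColours : ∀ {n} (L : Fin n → List ℕ) {v x} → x ∈ˡ L v → x ∈ˡ allColours L
∈-allColours {suc n} L {zero}  x∈ = ∈-++⁺ˡ x∈
∈-allColours {suc n} L {suc v} x∈ = ∈-++⁺ʳ (L zero) (∈-allColours (L ∘ suc) x∈)

module _ (H : Hypergraph) where

  Colourable : (Fin (n H) → List ℕ) → Set
  Colourable L = Choice L (Proper H)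

  ColourableFrom : ℕ → (Fin (n H) → List ℕ) → Set
  ColourableFrom k L = (∀ v → length (L v) ≡ k) → (∀ v → Unique (L v)) → Colourable L

  ChoosableBelow : ℕ → ℕ → Set
  ChoosableBelow k N = ∀ L → (∀ v → L v ∈ˡ allLists N k) → ColourableFrom k L

  choosableBelow? : ∀ k N → Dec (ChoosableBelow k N)
  choosableBelow? k N = ∀-choice? (λ _ → allLists N k) resp λ L →
    all? (λ v → length (L v) ℕ.≟ k) →-dec all? (λ v → unique? (L v)) →-dec ∃-choice? L proper-resp (proper? H)
    where
    proper-resp : ∀ {c c′} → (∀ v → c v ≡ c′ v) → Proper H c → Proper H c′
    proper-resp c≗c′ proper e e∈ (a , mono) = proper e e∈ (a , λ v v∈e → trans (c≗c′ v) (mono v v∈e))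
    resp : ∀ {L L′} → (∀ v → L v ≡ L′ v) → ColourableFrom k L → ColourableFrom k L′
    resp L≗L′ colourable lengths unique =
      let (c , c∈ , proper) = colourable (λ v → trans (cong length (L≗L′ v)) (lengths v))
                                         (λ v → subst Unique (sym (L≗L′ v)) (unique v))
      in c , (λ v → subst (c v ∈ˡ_) (L≗L′ v) (c∈ v)) , proper

  -- Colours are renamed by their first position in the concatenation of all the lists.
  choosableBelow⇒choosable : ∀ k → ChoosableBelow k (n H * k) → Choosable H k
  choosableBelow⇒choosable k below L lengths unique = c , c∈L , proper
    where
    code : ℕ → ℕ
    code x = position x (allColours L)
    L′ : Fin (n H) → List ℕ
    L′ v = map code (L v)
    lengths′ : ∀ v → length (L′ v) ≡ k
    lengths′ v = trans (length-map code (L v)) (lengths v)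
    code< : ∀ {v x} → x ∈ˡ L v → code x < n H * k
    code< {x = x} x∈ = subst (code x <_) (length-allColours L lengths) (position-< (allColours L) (∈-allColours L x∈))
    L′∈ : ∀ v → L′ v ∈ˡ allLists (n H * k) k
    L′∈ v = subst (λ m → L′ v ∈ˡ allLists _ m) (lengths′ v) (∈-allLists _ (L′ v) (AllP.map⁺ (All.tabulate code<)))
    unique′ : ∀ v → Unique (L′ v)
    unique′ v = Unique-map⁺ (λ x∈ y∈ → position-injective (allColours L) (∈-allColours L x∈) (∈-allColours L y∈))
                            (unique v)
    coloured = below L′ L′∈ lengths′ unique′
    decoded : ∀ v → ∃ λ x → x ∈ˡ L v × proj₁ coloured v ≡ code x
    decoded v = ∈-map⁻ code (proj₁ (proj₂ coloured) v)
    c : Fin (n H) → ℕ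
    c v = proj₁ (decoded v)
    c∈L : ∀ v → c v ∈ˡ L v
    c∈L v = proj₁ (proj₂ (decoded v))
    proper : Proper H c
    proper e e∈ (a , mono) =
      proj₂ (proj₂ coloured) e e∈ (code a , λ v v∈e → trans (proj₂ (proj₂ (decoded v))) (cong code (mono v v∈e)))

  choosable? : ∀ k → Dec (Choosable H k)
  choosable? k = map′ (choosableBelow⇒choosable k) (λ choosable L _ → choosable L) (choosableBelow? k (n H * k))

corollary3p2 : (H : Hypergraph) →
    Σ ℕ λ χL → Σ ℕ λ χP →
      IsListChromatic H χL × IsPaintNumber H χP ×
      χL ≤ χP × χP ≤ 2 * ceilEd H + 1
corollary3p2 H = χL , χP , χL-least , χP-least , proj₂ χL-least χP χP-choosable , proj₂ χP-least _ (paintable-2ed+1 H)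
  where
  open Σ (least (λ k → paintable? H ⊤ (λ _ → k)) _ (paintable-2ed+1 H)) renaming (proj₁ to χP; proj₂ to χP-least)
  χP-choosable = paintable⇒choosable H χP (proj₁ χP-least)
  open Σ (least (choosable? H) χP χP-choosable) renaming (proj₁ to χL; proj₂ to χL-least)
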